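{- On any metric space with exactly $k+1$ points and diameter $\mathrm{diam}$, the \textsc{Balance} algorithm for the $k$-server problem is $(1,\mathrm{diam})$-fair: for every request sequence $\sigma$ and every server $i$, $c_i\le \frac{\mathrm{cost}(\textsc{Balance},\sigma)}{k}+\mathrm{diam}$.
   Context: $k$-server problem: $k$ servers in a metric space serve an online request sequence; after request $\sigma_t$ some server must be at $\sigma_t$, moving costs the distance traveled; $c_i$ is server $i$'s total distance moved and $\mathrm{cost}=\sum_i c_i$. \textsc{Balance}: if the requested point is uncovered, move the server $i$ minimizing $c_i+d(s_i,\sigma_t)$, where $c_i$ is its cumulative cost so far and $s_i$ its current position (i.e. the server whose total cost after serving the request would be smallest).
   Formalization: The metric on the $k+1$ points takes rational values, so the diameter and all server costs are rational as well. -}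

module Defs where

open import Data.Nat using (ℕ; zero; suc)
open import Data.Fin using (Fin; zero; suc; _≟_)
open import Data.Rational using (ℚ; 0ℚ; _+_; _≤_)
open import Data.Product using (Σ; ∃; _×_; _,_)
open import Relation.Nullary using (¬_; yes; no)
open import Relation.Binary.PropositionalEquality using (_≡_)
open import Data.List using (List; []; _∷_)

record IsMetric {P : Set} (d : P → P → ℚ) : Set where
  field
    nonneg   : ∀ x y → 0ℚ ≤ d x y
    zero-iff : ∀ x y → d x y ≡ 0ℚ → x ≡ y
    refl-0   : ∀ x → d x x ≡ 0ℚ
    symm     : ∀ x y → d x y ≡ d y x
    triangle : ∀ x y z → d x z ≤ d x y + d y z

IsDiameter : {P : Set} → (P → P → ℚ) → ℚ → Set
IsDiameter {P} d D = (∀ x y → d x y ≤ D) × (Σ P λ x → Σ P λ y → d x y ≡ D)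

sumFin : (k : ℕ) → (Fin k → ℚ) → ℚ
sumFin zero    f = 0ℚ
sumFin (suc k) f = f zero + sumFin k (λ i → f (suc i))

record State (k : ℕ) (P : Set) : Set where
  constructor ⟨_,_⟩
  field
    pos  : Fin k → P
    cost : Fin k → ℚ

open State public

update : {k : ℕ} {A : Set} → (Fin k → A) → Fin k → A → Fin k → A
update f i a j with j ≟ i
... | yes _ = a
... | no  _ = f j

-- One step of Balance on request r (any tie-breaking among minimisers allowed).
data BalanceStep {k : ℕ} {P : Set} (d : P → P → ℚ) :
       State k P → P → State k P → Set where
  covered : ∀ {s c r} (i : Fin k) → s i ≡ r →
            BalanceStep d ⟨ s , c ⟩ r ⟨ s , c ⟩
  move    : ∀ {s c r} (i : Fin k) →
            (∀ j → ¬ (s j ≡ r)) →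
            (∀ j → c i + d (s i) r ≤ c j + d (s j) r) →
            BalanceStep d ⟨ s , c ⟩ r
              ⟨ update s i r , update c i (c i + d (s i) r) ⟩

data BalanceRun {k : ℕ} {P : Set} (d : P → P → ℚ) :
       State k P → List P → State k P → Set where
  done : ∀ {st} → BalanceRun d st [] st
  step : ∀ {st st' st'' r σ} → BalanceStep d st r st' →
         BalanceRun d st' σ st'' → BalanceRun d st (r ∷ σ) st''

-- Balance moves server i only if c_i + d(s_i, r) ≤ c_j + d(s_j, r) ≤ c_j + diam for every j, while the
-- other costs stay unchanged and c_i only grows; so the costs always lie within diam of one another.
-- Then c_i − diam bounds every c_j from below, hence also their mean cost/k.
{-# OPTIONS --safe #-}
module Submission where

open import Defs
open import Data.Nat using (ℕ; zero; suc; NonZero)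
open import Data.Fin using (Fin)
open import Data.Integer using (+_)
open import Data.Rational using (ℚ; 0ℚ; 1ℚ; -_; _-_; _+_; _*_; _/_; _≤_)
open import Data.List using (List)

import Data.Fin as Fin
import Data.Integer as ℤ
import Data.Integer.Properties as ℤ
open import Data.Rational.Literals using (fromℤ)
open import Data.Rational.Properties
open import Algebra.Properties.Group +-0-group using (//-rightDividesˡ; //-rightDividesʳ)
import Data.Rational.Unnormalised as ℚᵘ
import Data.Rational.Unnormalised.Properties as ℚᵘ
import Data.Nat.Coprimality as Coprimality
open import Data.Product using (proj₁)
open import Function using (_∘_)
open import Relation.Nullary using (yes; no)
open import Relation.Binary.PropositionalEquality using (_≡_; refl; sym; trans; cong)

p≤p+q : ∀ p {q} → 0ℚ ≤ q → p ≤ p + q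
p≤p+q p {q} 0≤q = ≤-trans (≤-reflexive (sym (+-identityʳ p))) (+-monoʳ-≤ p 0≤q)

fromℤ-suc : ∀ n → fromℤ (+ suc n) ≡ 1ℚ + fromℤ (+ n)
fromℤ-suc n = toℚᵘ-injective (ℚᵘ.≃-trans (ℚᵘ.*≡* numerators) (ℚᵘ.≃-sym (toℚᵘ-homo-+ 1ℚ (fromℤ (+ n)))))
  where
  numerators : + suc n ℤ.* + 1 ≡ (+ 1 ℤ.* + 1 ℤ.+ + n ℤ.* + 1) ℤ.* + 1
  numerators rewrite ℤ.*-identityʳ (+ n) = refl

fromℤ-*-inverseʳ : ∀ n .{{_ : NonZero n}} → fromℤ (+ n) * (+ 1 / n) ≡ 1ℚ
fromℤ-*-inverseʳ (suc m) =
  trans (cong (fromℤ (+ suc m) *_) (normalize-coprime (Coprimality.1-coprimeTo (suc m))))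
        (*-inverseʳ (fromℤ (+ suc m)))

sumFin-lowerBound : ∀ n (f : Fin n → ℚ) {x} → (∀ j → x ≤ f j) → x * fromℤ (+ n) ≤ sumFin n f
sumFin-lowerBound zero    f {x} x≤f = ≤-reflexive (*-zeroʳ x)
sumFin-lowerBound (suc n) f {x} x≤f = begin
  x * fromℤ (+ suc n)        ≡⟨ cong (x *_) (fromℤ-suc n) ⟩
  x * (1ℚ + fromℤ (+ n))     ≡⟨ *-distribˡ-+ x 1ℚ (fromℤ (+ n)) ⟩
  x * 1ℚ + x * fromℤ (+ n)   ≡⟨ cong (_+ x * fromℤ (+ n)) (*-identityʳ x) ⟩
  x + x * fromℤ (+ n)        ≤⟨ +-mono-≤ (x≤f Fin.zero) (sumFin-lowerBound n (f ∘ Fin.suc) (x≤f ∘ Fin.suc)) ⟩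
  sumFin (suc n) f           ∎
  where open ≤-Reasoning

≤-mean : ∀ n .{{_ : NonZero n}} (f : Fin n → ℚ) {x} → (∀ j → x ≤ f j) → x ≤ sumFin n f * (+ 1 / n)
≤-mean n f {x} x≤f = begin
  x                                  ≡⟨ sym (*-identityʳ x) ⟩
  x * 1ℚ                             ≡⟨ cong (x *_) (sym (fromℤ-*-inverseʳ n)) ⟩
  x * (fromℤ (+ n) * (+ 1 / n))      ≡⟨ sym (*-assoc x (fromℤ (+ n)) (+ 1 / n)) ⟩
  x * fromℤ (+ n) * (+ 1 / n)        ≤⟨ *-monoʳ-≤-nonNeg (+ 1 / n) {{normalize-nonNeg 1 n}} (sumFin-lowerBound n f x≤f) ⟩
  sumFin n f * (+ 1 / n)             ∎
  where open ≤-Reasoning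

≤-mean+ : ∀ n .{{_ : NonZero n}} (f : Fin n → ℚ) {x D} → (∀ j → x ≤ f j + D) → x ≤ sumFin n f * (+ 1 / n) + D
≤-mean+ n f {x} {D} x≤f+D = begin
  x                              ≡⟨ sym (//-rightDividesˡ D x) ⟩
  x - D + D                      ≤⟨ +-monoˡ-≤ D (≤-mean n f x-D≤f) ⟩
  sumFin n f * (+ 1 / n) + D     ∎
  where
  open ≤-Reasoning
  x-D≤f : ∀ j → x - D ≤ f j
  x-D≤f j = ≤-trans (+-monoˡ-≤ (- D) (x≤f+D j)) (≤-reflexive (//-rightDividesʳ D (f j)))

CostsWithin : {k : ℕ} → ℚ → (Fin k → ℚ) → Set
CostsWithin D c = ∀ a b → c a ≤ c b + D

module _ {P : Set} {d : P → P → ℚ} {D : ℚ}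
         (nonneg : ∀ x y → 0ℚ ≤ d x y) (bounded : ∀ x y → d x y ≤ D) where

  D-nonNeg : P → 0ℚ ≤ D
  D-nonNeg x = ≤-trans (nonneg x x) (bounded x x)

  balanceStep-costsWithin : ∀ {k} {st : State k P} {r st'} → BalanceStep d st r st' →
                            CostsWithin D (cost st) → CostsWithin D (cost st')
  balanceStep-costsWithin (covered _ _) within = within
  balanceStep-costsWithin {st = ⟨ s , c ⟩} {r} (move i _ cheapest) within a b with a Fin.≟ i | b Fin.≟ i
  ... | yes _ | yes _ = p≤p+q _ (D-nonNeg r)
  ... | yes _ | no  _ = ≤-trans (cheapest b) (+-monoʳ-≤ (c b) (bounded (s b) r))
  ... | no  _ | yes _ = ≤-trans (within a i) (+-monoˡ-≤ D (p≤p+q (c i) (nonneg (s i) r)))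
  ... | no  _ | no  _ = within a b

  balanceRun-costsWithin : ∀ {k} {st : State k P} {σ st'} → BalanceRun d st σ st' →
                           CostsWithin D (cost st) → CostsWithin D (cost st')
  balanceRun-costsWithin done             within = within
  balanceRun-costsWithin (step first run) within =
    balanceRun-costsWithin run (balanceStep-costsWithin first within)

proposition1 : (k : ℕ) → .{{_ : NonZero k}} →
    (d : Fin (suc k) → Fin (suc k) → ℚ) → IsMetric d →
    (diam : ℚ) → IsDiameter d diam →
    (s₀ : Fin k → Fin (suc k)) →
    (σ : List (Fin (suc k))) → (final : State k (Fin (suc k))) →
    BalanceRun d ⟨ s₀ , (λ _ → 0ℚ) ⟩ σ final →
    (i : Fin k) →
    cost final i ≤ sumFin k (cost final) * ((+ 1) / k) + diam
proposition1 k d metric diam diameter s₀ σ final run i =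
  ≤-mean+ k (cost final) (balanceRun-costsWithin nonneg bounded run initially i)
  where
  open IsMetric metric using (nonneg)
  bounded : ∀ x y → d x y ≤ diam
  bounded = proj₁ diameter
  initially : CostsWithin diam (λ _ → 0ℚ)
  initially _ _ = p≤p+q 0ℚ (D-nonNeg nonneg bounded Fin.zero)
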